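{- Let $(\mathcal{C},\mathcal{M})$ be an AECat with the amalgamation property and $\mathop{\perp\!\!\!\perp}$ a basic independence relation. If $\mathop{\perp\!\!\!\perp}$ satisfies Independence Theorem then it satisfies 3-amalgamation. Conversely, if $\mathop{\perp\!\!\!\perp}$ satisfies 3-amalgamation then it satisfies Independence Theorem over models, i.e. the Independence Theorem property holds for all instances in which the domain of the base arrow $c$ is a model.
   Context: An AECat is a pair $(\mathcal{C},\mathcal{M})$ of accessible categories with $\mathcal{M}$ a full subcategory of $\mathcal{C}$, $\mathcal{M}$ having directed colimits preserved by the inclusion, and every arrow of $\mathcal{C}$ a monomorphism; objects of $\mathcal{M}$ are models. AP: every span of models completes to a commutative square into a model. An extension of a model $M$ is an arrow $M\to N$ with $N$ a model; given it and $a:A\to M$ we also write $a$ for $A\to M\to N$, and subobjects of $M$ are regarded as subobjects of $N$. $(a,b,\dots;M)$ means $M$ is a model and $a,b,\dots$ arrows into $M$. $\mathrm{gtp}((a_i)_i;M)=\mathrm{gtp}((a_i')_i;M')$ means $\mathrm{dom}(a_i)=\mathrm{dom}(a_i')$ and there are extensions $f:M\to N$, $f':M'\to N$ with $fa_i=f'a_i'$ for all $i$. $((a_i)_i/(b_j)_j;M)\sim((a_i')_i/(b_j)_j;M)$ if there are an extension $M\to N$ and $m_0:M_0\to N$ with $M_0$ a model, each $b_j$ factoring through $m_0$, and $\mathrm{gtp}((a_i)_i,m_0;N)=\mathrm{gtp}((a_i')_i,m_0;N)$; its transitive closure is $\mathrm{Lgtp}((a_i)_i/(b_j)_j;M)=\mathrm{Lgtp}((a_i')_i/(b_j)_j;M)$.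 A base class is a collection of objects of $\mathcal{C}$ containing all models. An independence relation is a relation on triples of subobjects of a model $M$, written $A\mathop{\perp\!\!\!\perp}_C^MB$ (arrows may replace the subobjects they represent), with base class $\mathrm{base}(\mathop{\perp\!\!\!\perp})$ meaning $A\mathop{\perp\!\!\!\perp}_C^MB$ implies $\mathrm{dom}(C)\in\mathrm{base}(\mathop{\perp\!\!\!\perp})$. It is basic if it satisfies: Invariance ($a\mathop{\perp\!\!\!\perp}_c^Mb$ and $\mathrm{gtp}(a,b,c;M)=\mathrm{gtp}(a',b',c';M')$ imply $a'\mathop{\perp\!\!\!\perp}_{c'}^{M'}b'$); Monotonicity ($A\mathop{\perp\!\!\!\perp}_C^MB$, $A'\le A$ imply $A'\mathop{\perp\!\!\!\perp}_C^MB$); Transitivity ($A\mathop{\perp\!\!\!\perp}_B^MC$, $A\mathop{\perp\!\!\!\perp}_C^MD$, $B\le C$ imply $A\mathop{\perp\!\!\!\perp}_B^MD$); Symmetry; Existence ($A\mathop{\perp\!\!\!\perp}_C^MC$ for $C$ in the base class); Extension (if $a\mathop{\perp\!\!\!\perp}_c^Mb$ and $b$ factors through $(b';M)$, there are an extension $M\to N$ and $(a';N)$ with $\mathrm{gtp}(a',b,c;N)=\mathrm{gtp}(a,b,c;M)$ and $a'\mathop{\perp\!\!\!\perp}_c^Nb'$); Union (if $(B_i)_{i\in I}$ is directed with a cocone into a model $M$ and $B=\mathrm{colim}_iB_i$ exists, then $A\mathop{\perp\!\!\!\perp}_C^MB_i$ for all $i$ implies $A\mathop{\perp\!\!\!\perp}_C^MB$).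 Independence Theorem: if $a\mathop{\perp\!\!\!\perp}_c^Mb$, $a'\mathop{\perp\!\!\!\perp}_c^Mb'$, $b\mathop{\perp\!\!\!\perp}_c^Mb'$ and $\mathrm{Lgtp}(a/c;M)=\mathrm{Lgtp}(a'/c;M)$, there are an extension $M\to N$ and $(a^*;N)$ with $\mathrm{Lgtp}(a^*,b/c;N)=\mathrm{Lgtp}(a,b/c;N)$, $\mathrm{Lgtp}(a^*,b'/c;N)=\mathrm{Lgtp}(a',b'/c;N)$ and $a^*\mathop{\perp\!\!\!\perp}_c^NM$. 3-amalgamation: whenever $M,N_1,N_2,N_3$ are models and $a_1:A\to N_1$, $a_3:A\to N_3$, $b_1:B\to N_1$, $b_2:B\to N_2$, $c_2:C\to N_2$, $c_3:C\to N_3$, $m_k:M\to N_k$ ($k=1,2,3$) are arrows with $a_1\mathop{\perp\!\!\!\perp}_{m_1}^{N_1}b_1$, $b_2\mathop{\perp\!\!\!\perp}_{m_2}^{N_2}c_2$, $c_3\mathop{\perp\!\!\!\perp}_{m_3}^{N_3}a_3$, $\mathrm{gtp}(a_1,m_1;N_1)=\mathrm{gtp}(a_3,m_3;N_3)$, $\mathrm{gtp}(b_1,m_1;N_1)=\mathrm{gtp}(b_2,m_2;N_2)$, $\mathrm{gtp}(c_2,m_2;N_2)=\mathrm{gtp}(c_3,m_3;N_3)$, there are a model $N$ and arrows $f_k:N_k\to N$ with $f_1m_1=f_2m_2=f_3m_3$, $f_1a_1=f_3a_3$, $f_1b_1=f_2b_2$, $f_2c_2=f_3c_3$, and $f_1a_1\mathop{\perp\!\!\!\perp}_{f_1m_1}^{N}f_2$.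 -}

module Defs where

open import Level using (Level; _⊔_) renaming (suc to lsuc)
open import Data.Nat using (ℕ; zero; suc)
open import Data.Fin using (Fin; zero; suc)
open import Data.Product using (Σ; ∃; _×_; _,_; proj₁; proj₂; ∃-syntax; Σ-syntax)
open import Data.Empty using (⊥)
open import Relation.Nullary using (¬_)
open import Relation.Binary.PropositionalEquality using (_≡_)
open import Relation.Binary.Construct.Closure.Transitive using (TransClosure)
open import Data.Vec.Functional using (Vector; []; _∷_)

record Category (o h : Level) : Set (lsuc (o ⊔ h)) where
  infixr 9 _∘_
  field
    Obj  : Set o
    Hom  : Obj → Obj → Set h
    id   : ∀ {A} → Hom A A
    _∘_  : ∀ {A B C} → Hom B C → Hom A B → Hom A C
    assoc : ∀ {A B C D} (f : Hom C D) (g : Hom B C) (k : Hom A B) →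
            (f ∘ g) ∘ k ≡ f ∘ (g ∘ k)
    identityˡ : ∀ {A B} (f : Hom A B) → id ∘ f ≡ f
    identityʳ : ∀ {A B} (f : Hom A B) → f ∘ id ≡ f

  Mono : ∀ {A B} → Hom A B → Set (o ⊔ h)
  Mono {A} f = ∀ {X} (g k : Hom X A) → f ∘ g ≡ f ∘ k → g ≡ k

  IsIso : ∀ {A B} → Hom A B → Set h
  IsIso {A} {B} f = Σ (Hom B A) λ g → (g ∘ f ≡ id) × (f ∘ g ≡ id)

Full : ∀ {o h p} (𝒞 : Category o h) → (Category.Obj 𝒞 → Set p) → Category (o ⊔ p) h
Full 𝒞 P = record
  { Obj = Σ Obj P
  ; Hom = λ X Y → Hom (proj₁ X) (proj₁ Y)
  ; id = id
  ; _∘_ = _∘_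
  ; assoc = assoc
  ; identityˡ = identityˡ
  ; identityʳ = identityʳ
  }
  where open Category 𝒞

record IndexPreorder (i : Level) : Set (lsuc i) where
  field
    Carrier : Set i
    _≲_     : Carrier → Carrier → Set i
    ≲-refl  : ∀ {x} → x ≲ x
    ≲-trans : ∀ {x y z} → x ≲ y → y ≲ z → x ≲ z

Directed : ∀ {i} → IndexPreorder i → Set i
Directed I = Carrier × (∀ x y → ∃[ z ] (x ≲ z × y ≲ z))
  where open IndexPreorder I

module _ {o h : Level} (𝒞 : Category o h) where
  open Category 𝒞

  record Diagram {i} (I : IndexPreorder i) : Set (o ⊔ h ⊔ i) where
    open IndexPreorder I
    field
      D    : Carrier → Obj
      map  : ∀ {x y} → x ≲ y → Hom (D x) (D y)
      map-irr  : ∀ {x y} (p q : x ≲ y) → map p ≡ map q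
      map-id   : ∀ {x} (p : x ≲ x) → map p ≡ id
      map-comp : ∀ {x y z} (p : x ≲ y) (q : y ≲ z) → map (≲-trans p q) ≡ map q ∘ map p

  record Cocone {i} {I : IndexPreorder i} (Δ : Diagram I) : Set (o ⊔ h ⊔ i) where
    open IndexPreorder I
    open Diagram Δ
    field
      apex : Obj
      leg  : ∀ x → Hom (D x) apex
      commute : ∀ {x y} (p : x ≲ y) → leg y ∘ map p ≡ leg x

  IsColimit : ∀ {i} {I : IndexPreorder i} {Δ : Diagram I} → Cocone Δ → Set (o ⊔ h ⊔ i)
  IsColimit {I = I} {Δ} K =
    ∀ (K' : Cocone Δ) →
      Σ (Hom (Cocone.apex K) (Cocone.apex K')) λ u →
        (∀ x → u ∘ Cocone.leg K x ≡ Cocone.leg K' x) ×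
        (∀ (u' : Hom (Cocone.apex K) (Cocone.apex K')) →
           (∀ x → u' ∘ Cocone.leg K x ≡ Cocone.leg K' x) → u' ≡ u)
    where open IndexPreorder I

-- Cardinals, represented by types K : Set i (classical reading)

_↣_ : ∀ {a b} → Set a → Set b → Set (a ⊔ b)
X ↣ Y = Σ (X → Y) λ f → ∀ x x' → f x ≡ f x' → x ≡ x'

_≺_ : ∀ {i} → Set i → Set i → Set i
X ≺ K = (X ↣ K) × ¬ (K ↣ X)

RegularCardinal : ∀ {i} → Set i → Set (lsuc i)
RegularCardinal {i} K =
  (Level.Lift i ℕ ↣ K) ×
  (∀ (X : Set i) (Y : X → Set i) → X ≺ K → (∀ x → Y x ≺ K) → Σ X Y ≺ K)

LambdaDirected : ∀ {i} → Set i → IndexPreorder i → Set (lsuc i)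
LambdaDirected {i} K I =
  ∀ (X : Set i) → X ≺ K → (e : X → Carrier) → ∃[ z ] (∀ x → e x ≲ z)
  where open IndexPreorder I

module _ {o h : Level} (𝒞 : Category o h) where
  open Category 𝒞

  -- λ-presentable: Hom(A,-) preserves λ-directed colimits
  -- (unfolded: essentially unique factorisation through a stage)
  Presentable : ∀ {i} → Set i → Obj → Set (o ⊔ h ⊔ lsuc i)
  Presentable {i} K A =
    ∀ (I : IndexPreorder i) → LambdaDirected K I →
    ∀ (Δ : Diagram 𝒞 I) (L : Cocone 𝒞 Δ) → IsColimit 𝒞 L →
      (∀ (f : Hom A (Cocone.apex L)) →
         ∃[ x ] Σ (Hom A (Diagram.D Δ x)) λ g → Cocone.leg L x ∘ g ≡ f) ×
      (∀ x (g g' : Hom A (Diagram.D Δ x)) →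
         Cocone.leg L x ∘ g ≡ Cocone.leg L x ∘ g' →
         ∃[ y ] Σ (IndexPreorder._≲_ I x y) λ p →
           Diagram.map Δ p ∘ g ≡ Diagram.map Δ p ∘ g')

  Accessible : (i : Level) → Set (o ⊔ h ⊔ lsuc i)
  Accessible i =
    Σ[ K ∈ Set i ] RegularCardinal K ×
      (∀ (I : IndexPreorder i) → LambdaDirected K I → (Δ : Diagram 𝒞 I) →
         Σ (Cocone 𝒞 Δ) (IsColimit 𝒞)) ×
      (Σ[ S ∈ Set i ] Σ[ G ∈ (S → Obj) ] (∀ s → Presentable K (G s)) ×
        (∀ (X : Obj) → Σ[ I ∈ IndexPreorder i ] LambdaDirected K I ×
           Σ[ Δ ∈ Diagram 𝒞 I ] (∀ x → ∃[ s ] (Diagram.D Δ x ≡ G s)) ×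
           Σ[ L ∈ Cocone 𝒞 Δ ] IsColimit 𝒞 L × (Cocone.apex L ≡ X)))

module _ {o h p : Level} (𝒞 : Category o h) (P : Category.Obj 𝒞 → Set p) where
  open Category 𝒞

  inclDiagram : ∀ {i} {I : IndexPreorder i} → Diagram (Full 𝒞 P) I → Diagram 𝒞 I
  inclDiagram Δ = record
    { D = λ x → proj₁ (D x) ; map = map ; map-irr = map-irr
    ; map-id = map-id ; map-comp = map-comp }
    where open Diagram Δ

  inclCocone : ∀ {i} {I : IndexPreorder i} {Δ : Diagram (Full 𝒞 P) I} →
               Cocone (Full 𝒞 P) Δ → Cocone 𝒞 (inclDiagram Δ)
  inclCocone K = record { apex = proj₁ apex ; leg = leg ; commute = commute }
    where open Cocone K

record AECat (o h p i : Level) : Set (lsuc (o ⊔ h ⊔ p ⊔ i)) where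
  field
    𝒞       : Category o h
    IsModel : Category.Obj 𝒞 → Set p
  open Category 𝒞 public
  field
    𝒞-accessible : Accessible 𝒞 i
    ℳ-accessible : Accessible (Full 𝒞 IsModel) i
    ℳ-directed-colimits :
      ∀ (I : IndexPreorder i) → Directed I → (Δ : Diagram (Full 𝒞 IsModel) I) →
        Σ[ L ∈ Cocone (Full 𝒞 IsModel) Δ ]
          IsColimit (Full 𝒞 IsModel) L × IsColimit 𝒞 (inclCocone 𝒞 IsModel L)
    all-mono : ∀ {A B} (f : Hom A B) → Mono f

module AECatNotions {o h p i : Level} (𝒜 : AECat o h p i) where
  open AECat 𝒜

  Model : Set (o ⊔ p)
  Model = Σ Obj IsModel

  ∣_∣ : Model → Obj
  ∣ M ∣ = proj₁ M

  -- extensions of M are arrows M → N with N a model; here written as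
  -- Hom ∣ M ∣ ∣ N ∣ with N : Model

  HasAP : Set (o ⊔ h ⊔ p)
  HasAP = ∀ (M N₁ N₂ : Model) (f₁ : Hom ∣ M ∣ ∣ N₁ ∣) (f₂ : Hom ∣ M ∣ ∣ N₂ ∣) →
    Σ[ N ∈ Model ] Σ[ g₁ ∈ Hom ∣ N₁ ∣ ∣ N ∣ ] Σ[ g₂ ∈ Hom ∣ N₂ ∣ ∣ N ∣ ]
      (g₁ ∘ f₁ ≡ g₂ ∘ f₂)

  Tup : ∀ {n} → Vector Obj n → Obj → Set h
  Tup {n} doms X = (k : Fin n) → Hom (doms k) X

  []ᵗ : ∀ {X} → Tup [] X
  []ᵗ ()

  infixr 5 _∷ᵗ_
  _∷ᵗ_ : ∀ {n A X} {doms : Vector Obj n} → Hom A X → Tup doms X → Tup (A ∷ doms) X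
  (a ∷ᵗ as) zero = a
  (a ∷ᵗ as) (suc k) = as k

  _⊚_ : ∀ {n X Y} {doms : Vector Obj n} → Hom X Y → Tup doms X → Tup doms Y
  (f ⊚ as) k = f ∘ as k

  -- gtp((a_k)_k; M) = gtp((a'_k)_k; M')  (equal domains are built into the typing)
  GtpEq : ∀ {n} {doms : Vector Obj n} (M M' : Model) →
          Tup doms ∣ M ∣ → Tup doms ∣ M' ∣ → Set (o ⊔ h ⊔ p)
  GtpEq M M' as as' =
    Σ[ N ∈ Model ] Σ[ f ∈ Hom ∣ M ∣ ∣ N ∣ ] Σ[ f' ∈ Hom ∣ M' ∣ ∣ N ∣ ]
      (∀ k → f ∘ as k ≡ f' ∘ as' k)

  LStep : ∀ {n m} {doms : Vector Obj n} {doms' : Vector Obj m} (M : Model) →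
          Tup doms' ∣ M ∣ → Tup doms ∣ M ∣ → Tup doms ∣ M ∣ → Set (o ⊔ h ⊔ p)
  LStep M bs as as' =
    Σ[ N ∈ Model ] Σ[ g ∈ Hom ∣ M ∣ ∣ N ∣ ] Σ[ M₀ ∈ Model ] Σ[ m₀ ∈ Hom ∣ M₀ ∣ ∣ N ∣ ]
      (∀ j → Σ[ u ∈ Hom _ ∣ M₀ ∣ ] (m₀ ∘ u ≡ g ∘ bs j)) ×
      GtpEq N N (m₀ ∷ᵗ (g ⊚ as)) (m₀ ∷ᵗ (g ⊚ as'))

  LgtpEq : ∀ {n m} {doms : Vector Obj n} {doms' : Vector Obj m} (M : Model) →
           Tup doms ∣ M ∣ → Tup doms' ∣ M ∣ → Tup doms ∣ M ∣ → Set (o ⊔ h ⊔ p)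
  LgtpEq M as bs as' = TransClosure (LStep M bs) as as'

  -- a relation on triples of subobjects of models, represented by arrows:
  -- IndRel r = Ind M a c b  means  a ⫫_c^M b
  IndRel : (r : Level) → Set (o ⊔ h ⊔ p ⊔ lsuc r)
  IndRel r = ∀ {A B C} (M : Model) → Hom A ∣ M ∣ → Hom C ∣ M ∣ → Hom B ∣ M ∣ → Set r

  module _ {r b : Level} (Ind : IndRel r) (base : Obj → Set b) where

    OnSubobjects : Set (o ⊔ h ⊔ p ⊔ r)
    OnSubobjects = ∀ {A B C A' B' C'} (M : Model)
      (a : Hom A ∣ M ∣) (c : Hom C ∣ M ∣) (b : Hom B ∣ M ∣)
      (u : Hom A' A) (v : Hom C' C) (w : Hom B' B) →
      IsIso u → IsIso v → IsIso w →
      Ind M a c b → Ind M (a ∘ u) (c ∘ v) (b ∘ w)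

    HasBase : Set (o ⊔ h ⊔ p ⊔ r ⊔ b)
    HasBase = (∀ (M : Obj) → IsModel M → base M) ×
              (∀ {A B C} (M : Model) (a : Hom A ∣ M ∣) (c : Hom C ∣ M ∣) (b : Hom B ∣ M ∣) →
                 Ind M a c b → base C)

    Invariance : Set (o ⊔ h ⊔ p ⊔ r)
    Invariance = ∀ {A B C} (M M' : Model)
      (a : Hom A ∣ M ∣) (b : Hom B ∣ M ∣) (c : Hom C ∣ M ∣)
      (a' : Hom A ∣ M' ∣) (b' : Hom B ∣ M' ∣) (c' : Hom C ∣ M' ∣) →
      Ind M a c b →
      GtpEq M M' (a ∷ᵗ b ∷ᵗ c ∷ᵗ []ᵗ) (a' ∷ᵗ b' ∷ᵗ c' ∷ᵗ []ᵗ) →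
      Ind M' a' c' b'

    Monotonicity : Set (o ⊔ h ⊔ p ⊔ r)
    Monotonicity = ∀ {A A' B C} (M : Model)
      (a : Hom A ∣ M ∣) (c : Hom C ∣ M ∣) (b : Hom B ∣ M ∣) (u : Hom A' A) →
      Ind M a c b → Ind M (a ∘ u) c b

    Transitivity : Set (o ⊔ h ⊔ p ⊔ r)
    Transitivity = ∀ {A B C D} (M : Model)
      (a : Hom A ∣ M ∣) (b : Hom B ∣ M ∣) (c : Hom C ∣ M ∣) (d : Hom D ∣ M ∣) →
      Ind M a b c → Ind M a c d → Σ[ u ∈ Hom B C ] (c ∘ u ≡ b) →
      Ind M a b d

    Symmetry : Set (o ⊔ h ⊔ p ⊔ r)
    Symmetry = ∀ {A B C} (M : Model)
      (a : Hom A ∣ M ∣) (c : Hom C ∣ M ∣) (b : Hom B ∣ M ∣) →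
      Ind M a c b → Ind M b c a

    Existence : Set (o ⊔ h ⊔ p ⊔ r ⊔ b)
    Existence = ∀ {A C} (M : Model) (a : Hom A ∣ M ∣) (c : Hom C ∣ M ∣) →
      base C → Ind M a c c

    Extension : Set (o ⊔ h ⊔ p ⊔ r)
    Extension = ∀ {A B B' C} (M : Model)
      (a : Hom A ∣ M ∣) (c : Hom C ∣ M ∣) (b : Hom B ∣ M ∣) (b' : Hom B' ∣ M ∣) →
      Ind M a c b → Σ[ u ∈ Hom B B' ] (b' ∘ u ≡ b) →
      Σ[ N ∈ Model ] Σ[ g ∈ Hom ∣ M ∣ ∣ N ∣ ] Σ[ a' ∈ Hom A ∣ N ∣ ]
        GtpEq N M (a' ∷ᵗ (g ∘ b) ∷ᵗ (g ∘ c) ∷ᵗ []ᵗ) (a ∷ᵗ b ∷ᵗ c ∷ᵗ []ᵗ) ×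
        Ind N a' (g ∘ c) (g ∘ b')

    Union : Set (o ⊔ h ⊔ p ⊔ lsuc i ⊔ r)
    Union = ∀ {A C} (M : Model) (a : Hom A ∣ M ∣) (c : Hom C ∣ M ∣)
      (I : IndexPreorder i) → Directed I → (Δ : Diagram 𝒞 I) →
      (β : ∀ x → Hom (Diagram.D Δ x) ∣ M ∣) →
      (∀ {x y} (q : IndexPreorder._≲_ I x y) → β y ∘ Diagram.map Δ q ≡ β x) →
      (L : Cocone 𝒞 Δ) → IsColimit 𝒞 L →
      (bU : Hom (Cocone.apex L) ∣ M ∣) → (∀ x → bU ∘ Cocone.leg L x ≡ β x) →
      (∀ x → Ind M a c (β x)) → Ind M a c bU

    record Basic : Set (o ⊔ h ⊔ p ⊔ lsuc i ⊔ r ⊔ b) where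
      field
        on-subobjects : OnSubobjects
        has-base      : HasBase
        invariance    : Invariance
        monotonicity  : Monotonicity
        transitivity  : Transitivity
        symmetry      : Symmetry
        existence     : Existence
        extension     : Extension
        union         : Union

  module _ {r : Level} (Ind : IndRel r) where

    ITInstance : ∀ {A B B' C} (M : Model)
      (a a' : Hom A ∣ M ∣) (b : Hom B ∣ M ∣) (b' : Hom B' ∣ M ∣) (c : Hom C ∣ M ∣) →
      Set (o ⊔ h ⊔ p ⊔ r)
    ITInstance {A} M a a' b b' c =
      Ind M a c b → Ind M a' c b' → Ind M b c b' →
      LgtpEq M (a ∷ᵗ []ᵗ) (c ∷ᵗ []ᵗ) (a' ∷ᵗ []ᵗ) →
      Σ[ N ∈ Model ] Σ[ g ∈ Hom ∣ M ∣ ∣ N ∣ ] Σ[ a* ∈ Hom A ∣ N ∣ ]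
        LgtpEq N (a* ∷ᵗ (g ∘ b) ∷ᵗ []ᵗ) ((g ∘ c) ∷ᵗ []ᵗ) ((g ∘ a) ∷ᵗ (g ∘ b) ∷ᵗ []ᵗ) ×
        LgtpEq N (a* ∷ᵗ (g ∘ b') ∷ᵗ []ᵗ) ((g ∘ c) ∷ᵗ []ᵗ) ((g ∘ a') ∷ᵗ (g ∘ b') ∷ᵗ []ᵗ) ×
        Ind N a* (g ∘ c) g

    IndependenceTheorem : Set (o ⊔ h ⊔ p ⊔ r)
    IndependenceTheorem = ∀ {A B B' C} (M : Model)
      (a a' : Hom A ∣ M ∣) (b : Hom B ∣ M ∣) (b' : Hom B' ∣ M ∣) (c : Hom C ∣ M ∣) →
      ITInstance M a a' b b' c

    IndependenceTheoremOverModels : Set (o ⊔ h ⊔ p ⊔ r)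
    IndependenceTheoremOverModels = ∀ {A B B'} (M : Model) (M₀ : Model)
      (a a' : Hom A ∣ M ∣) (b : Hom B ∣ M ∣) (b' : Hom B' ∣ M ∣) (c : Hom ∣ M₀ ∣ ∣ M ∣) →
      ITInstance M a a' b b' c

    ThreeAmalgamation : Set (o ⊔ h ⊔ p ⊔ r)
    ThreeAmalgamation = ∀ {A B C} (M N₁ N₂ N₃ : Model)
      (a₁ : Hom A ∣ N₁ ∣) (a₃ : Hom A ∣ N₃ ∣)
      (b₁ : Hom B ∣ N₁ ∣) (b₂ : Hom B ∣ N₂ ∣)
      (c₂ : Hom C ∣ N₂ ∣) (c₃ : Hom C ∣ N₃ ∣)
      (m₁ : Hom ∣ M ∣ ∣ N₁ ∣) (m₂ : Hom ∣ M ∣ ∣ N₂ ∣) (m₃ : Hom ∣ M ∣ ∣ N₃ ∣) →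
      Ind N₁ a₁ m₁ b₁ → Ind N₂ b₂ m₂ c₂ → Ind N₃ c₃ m₃ a₃ →
      GtpEq N₁ N₃ (a₁ ∷ᵗ m₁ ∷ᵗ []ᵗ) (a₃ ∷ᵗ m₃ ∷ᵗ []ᵗ) →
      GtpEq N₁ N₂ (b₁ ∷ᵗ m₁ ∷ᵗ []ᵗ) (b₂ ∷ᵗ m₂ ∷ᵗ []ᵗ) →
      GtpEq N₂ N₃ (c₂ ∷ᵗ m₂ ∷ᵗ []ᵗ) (c₃ ∷ᵗ m₃ ∷ᵗ []ᵗ) →
      Σ[ N ∈ Model ] Σ[ f₁ ∈ Hom ∣ N₁ ∣ ∣ N ∣ ] Σ[ f₂ ∈ Hom ∣ N₂ ∣ ∣ N ∣ ]
      Σ[ f₃ ∈ Hom ∣ N₃ ∣ ∣ N ∣ ]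
        (f₁ ∘ m₁ ≡ f₂ ∘ m₂) × (f₂ ∘ m₂ ≡ f₃ ∘ m₃) ×
        (f₁ ∘ a₁ ≡ f₃ ∘ a₃) × (f₁ ∘ b₁ ≡ f₂ ∘ b₂) × (f₂ ∘ c₂ ≡ f₃ ∘ c₃) ×
        Ind N (f₁ ∘ a₁) (f₁ ∘ m₁) f₂

-- Over a base that is a model, equality of Lgtp is equality of gtp with the base
-- adjoined: one ∼-step suffices, the base serving as its own M₀.
--
-- Given a 3-amalgamation problem, amalgamate N₁, N₂, N₃ into one model Q along the
-- type equalities of b and c. In Q the images of a₁ and a₃ have the same Lgtp over
-- the image of M, so the Independence Theorem gives a* ⫫ Q realising the type of a₁
-- over b₁ and that of a₃ over c₃; amalgamating these two type equalities solves the
-- problem, and a* ⫫ Q yields the required independence by monotonicity.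
-- Conversely, an instance of the Independence Theorem over a model M₀ ⊆ M is the
-- 3-amalgamation problem with N₁ = N₂ = N₃ = M over M₀, and a* is the image of a in N₁.
module Submission where

open import Defs
open import Level using (Level; _⊔_)
open import Data.Nat using (ℕ)
open import Data.Product using (_×_; _,_; Σ-syntax)
open import Data.Fin using (zero; suc)
open import Data.Vec.Functional using (Vector; _∷_)
open import Relation.Binary.PropositionalEquality
open import Relation.Binary.Construct.Closure.Transitive using ([_]) renaming (_∷_ to _◅_)

module _ {o h p i : Level} (𝒜 : AECat o h p i) where
  open AECat 𝒜
  open AECatNotions 𝒜

  private
    variable
      n n' : ℕ
      doms : Vector Obj n
      doms' : Vector Obj n'
      X Y Z : Model

  -- GtpEq X Y and LStep M mention the models only through their carriers, so the
  -- models cannot be inferred and are passed explicitly below.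

  whiskerˡ : ∀ {A B C D E} (u : Hom D E) {v : Hom B D} {w : Hom C D} {x : Hom A B} {y : Hom A C} →
             v ∘ x ≡ w ∘ y → (u ∘ v) ∘ x ≡ (u ∘ w) ∘ y
  whiskerˡ u {v} {w} {x} {y} e = begin
    (u ∘ v) ∘ x  ≡⟨ assoc u v x ⟩
    u ∘ (v ∘ x)  ≡⟨ cong (u ∘_) e ⟩
    u ∘ (w ∘ y)  ≡⟨ assoc u w y ⟨
    (u ∘ w) ∘ y  ∎
    where open ≡-Reasoning

  ∘-reassocˡ : ∀ {A B C D} (u : Hom C D) {x : Hom A C} {k : Hom B C} {y : Hom A B} →
               x ≡ k ∘ y → u ∘ x ≡ (u ∘ k) ∘ y
  ∘-reassocˡ u {k = k} {y} e = trans (cong (u ∘_) e) (sym (assoc u k y))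

  Amalgam : ∀ {r} (Ind : IndRel r) {A B C M N₁ N₂ N₃ : Obj} →
            Hom A N₁ → Hom A N₃ → Hom B N₁ → Hom B N₂ → Hom C N₂ → Hom C N₃ →
            Hom M N₁ → Hom M N₂ → Hom M N₃ → Set (o ⊔ h ⊔ p ⊔ r)
  Amalgam Ind {N₁ = N₁} {N₂} {N₃} a₁ a₃ b₁ b₂ c₂ c₃ m₁ m₂ m₃ =
    Σ[ N ∈ Model ] Σ[ f₁ ∈ Hom N₁ ∣ N ∣ ] Σ[ f₂ ∈ Hom N₂ ∣ N ∣ ] Σ[ f₃ ∈ Hom N₃ ∣ N ∣ ]
      (f₁ ∘ m₁ ≡ f₂ ∘ m₂) × (f₂ ∘ m₂ ≡ f₃ ∘ m₃) ×
      (f₁ ∘ a₁ ≡ f₃ ∘ a₃) × (f₁ ∘ b₁ ≡ f₂ ∘ b₂) × (f₂ ∘ c₂ ≡ f₃ ∘ c₃) ×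
      Ind N (f₁ ∘ a₁) (f₁ ∘ m₁) f₂

  GtpEq-refl : (xs : Tup doms ∣ X ∣) → GtpEq X X xs xs
  GtpEq-refl {X = X} xs = X , id , id , λ _ → refl

  GtpEq-sym : {xs : Tup doms ∣ X ∣} {ys : Tup doms ∣ Y ∣} → GtpEq X Y xs ys → GtpEq Y X ys xs
  GtpEq-sym (N , f , f' , e) = N , f' , f , λ k → sym (e k)

  GtpEq-via : {xs : Tup doms ∣ X ∣} {ys : Tup doms ∣ Y ∣} (u : Hom ∣ Y ∣ ∣ X ∣) →
              (∀ k → xs k ≡ u ∘ ys k) → GtpEq X Y xs ys
  GtpEq-via {X = X} {xs = xs} u e = X , id , u , λ k → trans (identityˡ (xs k)) (e k)

  GtpEq-swap : ∀ {A B} {x₁ : Hom A ∣ X ∣} {x₂ : Hom B ∣ X ∣} {y₁ : Hom A ∣ Y ∣} {y₂ : Hom B ∣ Y ∣} →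
               GtpEq X Y (x₁ ∷ᵗ x₂ ∷ᵗ []ᵗ) (y₁ ∷ᵗ y₂ ∷ᵗ []ᵗ) →
               GtpEq X Y (x₂ ∷ᵗ x₁ ∷ᵗ []ᵗ) (y₂ ∷ᵗ y₁ ∷ᵗ []ᵗ)
  GtpEq-swap (N , f , f' , e) = N , f , f' , λ { zero → e (suc zero) ; (suc zero) → e zero }

  LStep⇒GtpEq : ∀ {C} {M : Model} {c : Hom C ∣ M ∣} {xs ys : Tup doms ∣ M ∣} →
                LStep M (c ∷ᵗ []ᵗ) xs ys → GtpEq M M (c ∷ᵗ xs) (c ∷ᵗ ys)
  LStep⇒GtpEq {c = c} {xs} {ys} (N , g , M₀ , m₀ , factors , R , f , f' , e) =
    R , f ∘ g , f' ∘ g , agree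
    where
    agree : ∀ k → (f ∘ g) ∘ (c ∷ᵗ xs) k ≡ (f' ∘ g) ∘ (c ∷ᵗ ys) k
    agree zero with factors zero
    ... | u , m₀u≡gc = begin
      (f ∘ g) ∘ c    ≡⟨ whiskerˡ f (sym m₀u≡gc) ⟩
      (f ∘ m₀) ∘ u   ≡⟨ cong (_∘ u) (e zero) ⟩
      (f' ∘ m₀) ∘ u  ≡⟨ whiskerˡ f' m₀u≡gc ⟩
      (f' ∘ g) ∘ c   ∎
      where open ≡-Reasoning
    agree (suc k) = trans (assoc f g (xs k)) (trans (e (suc k)) (sym (assoc f' g (ys k))))

  -- A single ∼-step, in which the base, being a model, serves as its own M₀.
  GtpEq⇒LgtpEq : {M₀ M : Model} (c : Hom ∣ M₀ ∣ ∣ M ∣) {xs ys : Tup doms ∣ M ∣} →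
                 GtpEq M M (c ∷ᵗ xs) (c ∷ᵗ ys) → LgtpEq M xs (c ∷ᵗ []ᵗ) ys
  GtpEq⇒LgtpEq {M₀ = M₀} {M} c {xs} {ys} (R , f , f' , e) =
    [ M , id , M₀ , c , (λ { zero → id , trans (identityʳ c) (sym (identityˡ c)) }) ,
      R , f , f' , agree ]
    where
    agree : ∀ k → f ∘ (c ∷ᵗ (id ⊚ xs)) k ≡ f' ∘ (c ∷ᵗ (id ⊚ ys)) k
    agree zero = e zero
    agree (suc k) = trans (cong (f ∘_) (identityˡ (xs k)))
                      (trans (e (suc k)) (cong (f' ∘_) (sym (identityˡ (ys k)))))

  module _ {r b : Level} {Ind : IndRel r} {base : Obj → Set b} (basic : Basic Ind base) where
    open Basic basic

    Ind-along : ∀ {A B C} {a : Hom A ∣ X ∣} {c : Hom C ∣ X ∣} {b : Hom B ∣ X ∣}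
                {a' : Hom A ∣ Y ∣} {c' : Hom C ∣ Y ∣} {b' : Hom B ∣ Y ∣} (u : Hom ∣ X ∣ ∣ Y ∣) →
                u ∘ a ≡ a' → u ∘ c ≡ c' → u ∘ b ≡ b' → Ind X a c b → Ind Y a' c' b'
    Ind-along {X = X} {Y} {a = a} {c} {b} {a'} {c'} {b'} u ua≡a' uc≡c' ub≡b' a⫫b =
      invariance X Y a b c a' b' c' a⫫b (GtpEq-sym {X = Y} {X} (GtpEq-via {X = Y} {X} u λ
        { zero → sym ua≡a' ; (suc zero) → sym ub≡b' ; (suc (suc zero)) → sym uc≡c' }))

    Ind-monoʳ : ∀ {A B B' C} (M : Model) {a : Hom A ∣ M ∣} {c : Hom C ∣ M ∣} {b : Hom B ∣ M ∣}
                (u : Hom B' B) → Ind M a c b → Ind M a c (b ∘ u)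
    Ind-monoʳ M {a} {c} {b} u a⫫b =
      symmetry M (b ∘ u) c a (monotonicity M b c a u (symmetry M a c b a⫫b))

  module _ (ap : HasAP) where

    GtpEq-join : {xs : Tup doms ∣ X ∣} {ys : Tup doms ∣ Y ∣}
                 {xs' : Tup doms' ∣ X ∣} {zs : Tup doms' ∣ Z ∣} →
                 GtpEq X Y xs ys → GtpEq X Z xs' zs →
                 Σ[ W ∈ Model ] Σ[ w ∈ Hom ∣ X ∣ ∣ W ∣ ] Σ[ v ∈ Hom ∣ Y ∣ ∣ W ∣ ] Σ[ v' ∈ Hom ∣ Z ∣ ∣ W ∣ ]
                   (∀ k → w ∘ xs k ≡ v ∘ ys k) × (∀ k → w ∘ xs' k ≡ v' ∘ zs k)
    GtpEq-join {X = X} {xs' = xs'} (R , f , g , e) (R' , f' , g' , e') with ap X R R' f f'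
    ... | W , u , u' , uf≡u'f' =
      W , u ∘ f , u ∘ g , u' ∘ g' , (λ k → whiskerˡ u (e k)) ,
      λ k → trans (cong (_∘ xs' k) uf≡u'f') (whiskerˡ u' (e' k))

    GtpEq-trans : {xs : Tup doms ∣ X ∣} {ys : Tup doms ∣ Y ∣} {zs : Tup doms ∣ Z ∣} →
                  GtpEq X Y xs ys → GtpEq Y Z ys zs → GtpEq X Z xs zs
    GtpEq-trans {X = X} {Y} {Z} {xs} {ys} {zs} xy yz
      with GtpEq-join {X = Y} {Y = X} {Z = Z} {xs = ys} {xs} {ys} {zs} (GtpEq-sym {X = X} {Y} xy) yz
    ... | W , _ , v , v' , e , e' = W , v , v' , λ k → trans (sym (e k)) (e' k)

    GtpEq-transport : ∀ {X' Y'} {xs : Tup doms ∣ X ∣} {ys : Tup doms ∣ Y ∣}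
                      {xs' : Tup doms ∣ X' ∣} {ys' : Tup doms ∣ Y' ∣}
                      (u : Hom ∣ X ∣ ∣ X' ∣) (v : Hom ∣ Y ∣ ∣ Y' ∣) →
                      (∀ k → xs' k ≡ u ∘ xs k) → (∀ k → ys' k ≡ v ∘ ys k) →
                      GtpEq X Y xs ys → GtpEq X' Y' xs' ys'
    GtpEq-transport {X = X} {Y} {X'} {Y'} {xs = xs} {ys} {ys' = ys'} u v eu ev xy =
      GtpEq-trans {X = X'} {X} {Y'} {ys = xs} (GtpEq-via {X = X'} {Y = X} u eu)
        (GtpEq-trans {X = X} {Y} {Y'} {ys = ys} xy
          (GtpEq-sym {X = Y'} {Y} {xs = ys'} (GtpEq-via {X = Y'} {Y = Y} v ev)))

    LgtpEq⇒GtpEq : ∀ {C} {M : Model} {c : Hom C ∣ M ∣} {xs ys : Tup doms ∣ M ∣} →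
                   LgtpEq M xs (c ∷ᵗ []ᵗ) ys → GtpEq M M (c ∷ᵗ xs) (c ∷ᵗ ys)
    LgtpEq⇒GtpEq {M = M} [ step ] = LStep⇒GtpEq {M = M} step
    LgtpEq⇒GtpEq {M = M} {c = c} (_◅_ {y = ys} step steps) =
      GtpEq-trans {X = M} {M} {M} {ys = c ∷ᵗ ys}
        (LStep⇒GtpEq {M = M} step) (LgtpEq⇒GtpEq {M = M} steps)

    LgtpEq⇒GtpEq-via : ∀ {C} {M N : Model} {c : Hom C ∣ M ∣} {xs ys : Tup doms ∣ M ∣}
                       {zs : Tup (C ∷ doms) ∣ N ∣} →
                       LgtpEq M xs (c ∷ᵗ []ᵗ) ys → (u : Hom ∣ N ∣ ∣ M ∣) →
                       (∀ k → (c ∷ᵗ ys) k ≡ u ∘ zs k) → GtpEq M N (c ∷ᵗ xs) zs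
    LgtpEq⇒GtpEq-via {M = M} {N} {c} {ys = ys} xs≡ys u e =
      GtpEq-trans {X = M} {M} {N} {ys = c ∷ᵗ ys}
        (LgtpEq⇒GtpEq {M = M} xs≡ys) (GtpEq-via {X = M} {N} u e)

    LgtpEq-images : ∀ {M₀ M N : Model} (c : Hom ∣ M₀ ∣ ∣ M ∣) (f f' : Hom ∣ M ∣ ∣ N ∣)
                    {zs : Tup doms ∣ M ∣} {xs ys : Tup doms ∣ N ∣} →
                    f ∘ c ≡ f' ∘ c → (∀ k → xs k ≡ f ∘ zs k) → (∀ k → ys k ≡ f' ∘ zs k) →
                    LgtpEq N xs ((f' ∘ c) ∷ᵗ []ᵗ) ys
    LgtpEq-images {M₀ = M₀} {M} {N} c f f' {zs} {xs} {ys} fc≡f'c xs≡fzs ys≡f'zs =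
      GtpEq⇒LgtpEq {M₀ = M₀} {N} (f' ∘ c)
        (GtpEq-trans {X = N} {M} {N} {ys = c ∷ᵗ zs}
          (GtpEq-via {X = N} {M} f λ { zero → sym fc≡f'c ; (suc k) → xs≡fzs k })
          (GtpEq-sym {X = N} {M} {xs = (f' ∘ c) ∷ᵗ ys}
            (GtpEq-via {X = N} {M} f' λ { zero → refl ; (suc k) → ys≡f'zs k })))

    module _ {r b : Level} {Ind : IndRel r} {base : Obj → Set b} (basic : Basic Ind base) where
      open Basic basic

      amalgam-of-realisation :
        ∀ {A B C} {M N₁ N₂ N₃ P : Model} {a₁ : Hom A ∣ N₁ ∣} {a₃ : Hom A ∣ N₃ ∣}
        {b₁ : Hom B ∣ N₁ ∣} {b₂ : Hom B ∣ N₂ ∣} {c₂ : Hom C ∣ N₂ ∣} {c₃ : Hom C ∣ N₃ ∣}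
        {m₁ : Hom ∣ M ∣ ∣ N₁ ∣} {m₂ : Hom ∣ M ∣ ∣ N₂ ∣} {m₃ : Hom ∣ M ∣ ∣ N₃ ∣}
        (n : Hom ∣ N₂ ∣ ∣ P ∣) {m : Hom ∣ M ∣ ∣ P ∣} {b : Hom B ∣ P ∣} {c : Hom C ∣ P ∣}
        (a* : Hom A ∣ P ∣) →
        n ∘ m₂ ≡ m → n ∘ b₂ ≡ b → n ∘ c₂ ≡ c →
        GtpEq P N₁ (m ∷ᵗ a* ∷ᵗ b ∷ᵗ []ᵗ) (m₁ ∷ᵗ a₁ ∷ᵗ b₁ ∷ᵗ []ᵗ) →
        GtpEq P N₃ (m ∷ᵗ a* ∷ᵗ c ∷ᵗ []ᵗ) (m₃ ∷ᵗ a₃ ∷ᵗ c₃ ∷ᵗ []ᵗ) →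
        Ind P a* m n → Amalgam Ind a₁ a₃ b₁ b₂ c₂ c₃ m₁ m₂ m₃
      amalgam-of-realisation {N₁ = N₁} {N₃ = N₃} {P} n a* nm₂≡m nb₂≡b nc₂≡c P≡N₁ P≡N₃ a*⫫n
        with GtpEq-join {X = P} {Y = N₁} {Z = N₃} P≡N₁ P≡N₃
      ... | W , w , f₁ , f₃ , e₁ , e₃ =
        W , f₁ , w ∘ n , f₃ ,
        trans (sym (e₁ zero)) (∘-reassocˡ w (sym nm₂≡m)) ,
        trans (sym (∘-reassocˡ w (sym nm₂≡m))) (e₃ zero) ,
        trans (sym (e₁ (suc zero))) (e₃ (suc zero)) ,
        trans (sym (e₁ (suc (suc zero)))) (∘-reassocˡ w (sym nb₂≡b)) ,
        trans (sym (∘-reassocˡ w (sym nc₂≡c))) (e₃ (suc (suc zero))) ,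
        Ind-along basic w (e₁ (suc zero)) (e₁ zero) refl a*⫫n

      IT⇒3-amalgamation : IndependenceTheorem Ind → ThreeAmalgamation Ind
      IT⇒3-amalgamation IT M N₁ N₂ N₃ a₁ a₃ b₁ b₂ c₂ c₃ m₁ m₂ m₃ a₁⫫b₁ b₂⫫c₂ c₃⫫a₃ a₁≡a₃ b₁≡b₂ c₂≡c₃
        with GtpEq-join {X = N₂} {Y = N₁} {Z = N₃} (GtpEq-sym {X = N₁} {N₂} b₁≡b₂) c₂≡c₃
      ... | Q , n₂ , k₁ , k₃ , e₁ , e₃
        with IT Q (k₁ ∘ a₁) (k₃ ∘ a₃) (n₂ ∘ b₂) (n₂ ∘ c₂) (n₂ ∘ m₂)
               (Ind-along basic k₁ refl (sym (e₁ (suc zero))) (sym (e₁ zero)) a₁⫫b₁)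
               (Ind-along basic k₃ refl (sym (e₃ (suc zero))) (sym (e₃ zero))
                  (symmetry N₃ c₃ m₃ a₃ c₃⫫a₃))
               (Ind-along basic n₂ refl refl refl b₂⫫c₂)
               (GtpEq⇒LgtpEq {M₀ = M} {Q} (n₂ ∘ m₂)
                  (GtpEq-transport {X = N₁} {N₃} {Q} {Q} k₁ k₃
                     (λ { zero → e₁ (suc zero) ; (suc zero) → refl })
                     (λ { zero → e₃ (suc zero) ; (suc zero) → refl })
                     (GtpEq-swap {X = N₁} {N₃} a₁≡a₃)))
      ... | P , g , a* , a*b≡ab , a*c≡a'c , a*⫫Q =
        amalgam-of-realisation {M = M} {N₁} {N₂} {N₃} {P} (g ∘ n₂) a*
          (assoc g n₂ m₂) (assoc g n₂ b₂) (assoc g n₂ c₂)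
          (LgtpEq⇒GtpEq-via {M = P} {N₁} a*b≡ab (g ∘ k₁) λ
             { zero → ∘-reassocˡ g (e₁ (suc zero)) ; (suc zero) → ∘-reassocˡ g refl
             ; (suc (suc zero)) → ∘-reassocˡ g (e₁ zero) })
          (LgtpEq⇒GtpEq-via {M = P} {N₃} a*c≡a'c (g ∘ k₃) λ
             { zero → ∘-reassocˡ g (e₃ (suc zero)) ; (suc zero) → ∘-reassocˡ g refl
             ; (suc (suc zero)) → ∘-reassocˡ g (e₃ zero) })
          (Ind-monoʳ basic P n₂ a*⫫Q)

      3-amalgamation⇒IT-overModels : ThreeAmalgamation Ind → IndependenceTheoremOverModels Ind
      3-amalgamation⇒IT-overModels amalgamate M M₀ a a' b b' c a⫫b a'⫫b' b⫫b' a≡a'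
        with amalgamate M₀ M M M a a' b b b' b' c c c a⫫b b⫫b' (symmetry M a' c b' a'⫫b')
               (GtpEq-swap {X = M} {M} (LgtpEq⇒GtpEq {M = M} a≡a'))
               (GtpEq-refl {X = M} (b ∷ᵗ c ∷ᵗ []ᵗ)) (GtpEq-refl {X = M} (b' ∷ᵗ c ∷ᵗ []ᵗ))
      ... | N , f₁ , f₂ , f₃ , f₁c≡f₂c , f₂c≡f₃c , f₁a≡f₃a' , f₁b≡f₂b , f₂b'≡f₃b' , a*⫫f₂ =
        N , f₂ , f₁ ∘ a ,
        LgtpEq-images {M₀ = M₀} {M} {N} c f₁ f₂ {zs = a ∷ᵗ b ∷ᵗ []ᵗ} f₁c≡f₂c
          (λ { zero → refl ; (suc zero) → sym f₁b≡f₂b }) (λ { zero → refl ; (suc zero) → refl }) ,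
        LgtpEq-images {M₀ = M₀} {M} {N} c f₃ f₂ {zs = a' ∷ᵗ b' ∷ᵗ []ᵗ} (sym f₂c≡f₃c)
          (λ { zero → f₁a≡f₃a' ; (suc zero) → f₂b'≡f₃b' }) (λ { zero → refl ; (suc zero) → refl }) ,
        subst (λ d → Ind N (f₁ ∘ a) d f₂) f₁c≡f₂c a*⫫f₂

theorem5p2 : ∀ {o h p i r b : Level} (𝒜 : AECat o h p i) →
    AECatNotions.HasAP 𝒜 →
    (base : AECat.Obj 𝒜 → Set b) (Ind : AECatNotions.IndRel 𝒜 r) →
    AECatNotions.Basic 𝒜 Ind base →
    (AECatNotions.IndependenceTheorem 𝒜 Ind → AECatNotions.ThreeAmalgamation 𝒜 Ind) ×
    (AECatNotions.ThreeAmalgamation 𝒜 Ind → AECatNotions.IndependenceTheoremOverModels 𝒜 Ind)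
theorem5p2 𝒜 ap _ _ basic =
  IT⇒3-amalgamation 𝒜 ap basic , 3-amalgamation⇒IT-overModels 𝒜 ap basic
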